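{- Let $G$ be a finite directed multigraph. Then $\mathcal M_G$ equals the set of $\mathcal S\in\mathbb Z^{E(G)}$ such that (i) $\sum_{e:\,s(e)=v}m_e(\mathcal S)=\sum_{e:\,t(e)=v}m_e(\mathcal S)$ for every vertex $v\in V(G)$, and (ii) $\mathrm{supp}(\mathcal S)\subseteq\bigcup_{\mathcal C}\mathrm{supp}(\mathcal C)$, the union over all simple directed cycles $\mathcal C$ of $G$.
   Context: Elements $\mathcal S\in\mathbb Z^{E(G)}$ are formal sums $\sum_e m_e(\mathcal S)\,e$ of edges; $\mathrm{supp}(\mathcal S)=\{e: m_e(\mathcal S)\ne0\}$. A simple directed cycle is identified with the formal sum of its edges. $\mathcal M_G\subseteq\mathbb Z^{E(G)}$ is the subgroup of $\mathbb Z$-linear combinations of simple directed cycles. $s(e),t(e)$ denote the source and target of $e$. -}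

module Defs where

open import Data.Nat using (ℕ)
open import Data.Fin using (Fin; _≟_)
open import Data.Integer using (ℤ; +_; 0ℤ; _+_; _*_)
open import Data.List using (List; []; _∷_; _++_; map; foldr; allFin; filter; length)
open import Data.List.Relation.Unary.All using (All)
open import Data.List.Relation.Unary.Unique.Propositional using (Unique)
open import Data.Product using (Σ; _×_; _,_; ∃; ∃-syntax; proj₁; proj₂)
open import Data.Empty using (⊥)
open import Data.Unit using (⊤)
open import Relation.Binary.PropositionalEquality using (_≡_; _≢_)
open import Relation.Nullary.Decidable using (does)
open import Data.Bool using (if_then_else_)

record Digraph : Set where
  field
    nV : ℕ
    nE : ℕ
    s  : Fin nE → Fin nV
    t  : Fin nE → Fin nV
open Digraph public

ZE : Digraph → Set
ZE G = Fin (nE G) → ℤ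

sumℤ : List ℤ → ℤ
sumℤ = foldr _+_ 0ℤ

module _ (G : Digraph) where

  Chain : List (Fin (nE G)) → Set
  Chain [] = ⊤
  Chain (e ∷ []) = ⊤
  Chain (e ∷ f ∷ es) = (t G e ≡ s G f) × Chain (f ∷ es)

  IsSimpleCycle : List (Fin (nE G)) → Set
  IsSimpleCycle [] = ⊥
  IsSimpleCycle (e₀ ∷ rest) =
    Chain ((e₀ ∷ rest) ++ (e₀ ∷ [])) × Unique (map (s G) (e₀ ∷ rest))

  SimpleCycle : Set
  SimpleCycle = Σ (List (Fin (nE G))) IsSimpleCycle

  -- a cycle identified with the formal sum of its edges
  cycleSum : SimpleCycle → ZE G
  cycleSum (es , _) e = + length (filter (e ≟_) es)

  supp : ZE G → Fin (nE G) → Set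
  supp S e = S e ≢ 0ℤ

  -- M_G : ℤ-linear combinations of simple directed cycles (pointwise equality)
  InM : ZE G → Set
  InM S = Σ (List (ℤ × SimpleCycle)) λ L →
            ∀ e → S e ≡ sumℤ (map (λ cC → proj₁ cC * cycleSum (proj₂ cC) e) L)

  outSum inSum : ZE G → Fin (nV G) → ℤ
  outSum S v = sumℤ (map (λ e → if does (s G e ≟ v) then S e else 0ℤ) (allFin (nE G)))
  inSum  S v = sumℤ (map (λ e → if does (t G e ≟ v) then S e else 0ℤ) (allFin (nE G)))

  Balanced : ZE G → Set
  Balanced S = ∀ v → outSum S v ≡ inSum S v

  SuppInCycles : ZE G → Set
  SuppInCycles S = ∀ e → supp S e → ∃[ C ] supp (cycleSum C) e

-- (⇒) In a simple cycle the list of edge targets is a rotation of the list of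
-- edge sources, so every vertex is entered as often as it is left: the edge
-- vector of a cycle is balanced.  Balance is preserved by ℤ-linear
-- combinations, and an edge in the support of a combination of cycles lies in
-- the support of one of them.
--
-- (⇐) Adding ∣S e∣ copies of a cycle through e, for every e in the support of
-- S, yields a nonnegative balanced vector f = S + T with T ∈ M_G.  A nonnegative
-- balanced f ≠ 0 contains a simple cycle of f-positive edges: walking backwards
-- along positive edges (balance provides an incoming positive edge) repeats a
-- vertex within ∣V∣ steps.  Subtracting that cycle keeps f nonnegative and
-- balanced and lowers its total mass, so induction on the mass puts f in M_G,
-- and then S = f - T ∈ M_G.

module Submission where

open import Defs
open import Data.Nat as ℕ using (ℕ; zero; suc)
import Data.Nat.Properties as ℕP
open import Data.Fin as Fin using (Fin; _≟_)
import Data.Fin.Properties as FP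
open import Data.Integer as ℤ using (ℤ; +_; -[1+_]; 0ℤ; 1ℤ; _+_; _*_; -_; _-_; _≤_; _<_; ∣_∣)
import Data.Integer.Properties as ℤP
open import Data.Integer.Tactic.RingSolver using (solve-∀)
open import Algebra.Properties.CommutativeSemigroup ℤP.+-commutativeSemigroup using (interchange)
open import Data.List using (List; []; _∷_; _++_; map; allFin; filter; length; lookup; concatMap)
import Data.List.Properties as LP
open import Data.List.Relation.Unary.All as All using (All; []; _∷_)
import Data.List.Relation.Unary.All.Properties as AllP
open import Data.List.Relation.Unary.Any using (here; there)
open import Data.List.Relation.Unary.AllPairs using ([]; _∷_)
open import Data.List.Relation.Unary.Unique.Propositional using (Unique)
import Data.List.Relation.Unary.Unique.Propositional.Properties as UniqueP
open import Data.List.Relation.Unary.First as First using (first)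
open import Data.List.Relation.Unary.First.Properties using (toView)
open import Data.List.Membership.Propositional using (_∈_)
open import Data.List.Membership.Propositional.Properties using (∈-allFin; ∈-lookup)
open import Data.Product using (Σ-syntax; ∃-syntax; _×_; _,_; proj₁; proj₂)
open import Data.Sum using (_⊎_; inj₁; inj₂)
open import Data.Empty using (⊥-elim)
open import Data.Unit using (tt)
open import Data.Bool using (Bool; true; false; T; if_then_else_)
open import Relation.Binary.PropositionalEquality
open import Relation.Nullary using (yes; no)
open import Relation.Nullary.Decidable using (does; toWitness; fromWitness; isYes≗does)
open import Function.Bundles using (_⇔_; mk⇔)

NonNeg : {A : Set} → (A → ℤ) → Set
NonNeg f = ∀ x → 0ℤ ≤ f x

0<a+b⇒0<b : ∀ {a b} → a ≤ 0ℤ → 0ℤ < a + b → 0ℤ < b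
0<a+b⇒0<b {a} {b} a≤0 0<a+b =
  subst (0ℤ <_) (ℤP.+-identityˡ b) (ℤP.<-≤-trans 0<a+b (ℤP.+-monoˡ-≤ b a≤0))

does-refl : ∀ {n} (a : Fin n) → T (does (a ≟ a))
does-refl a = subst T (isYes≗does (a ≟ a)) (fromWitness refl)

does-sound : ∀ {n} {a b : Fin n} → T (does (a ≟ b)) → a ≡ b
does-sound {a = a} {b} h = toWitness (subst T (sym (isYes≗does (a ≟ b))) h)

plus-minus : ∀ a b → a + (b - a) ≡ b
plus-minus = solve-∀

plus-minus-cancel : ∀ a b → (a + b) - b ≡ a
plus-minus-cancel = solve-∀

neg≤∣∣ : ∀ i → - i ≤ + ∣ i ∣
neg≤∣∣ (+ n)    = ℤP.neg-≤-pos
neg≤∣∣ -[1+ n ] = ℤP.≤-refl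

neg≤∣∣* : ∀ i k → + k ≢ 0ℤ → - i ≤ + ∣ i ∣ * + k
neg≤∣∣* i zero    k≢0 = ⊥-elim (k≢0 refl)
neg≤∣∣* i (suc k) _   =
  ℤP.≤-trans (neg≤∣∣ i) (subst (+ ∣ i ∣ ≤_) (ℤP.pos-* ∣ i ∣ (suc k)) (ℤ.+≤+ (ℕP.m≤m*n ∣ i ∣ (suc k))))

-- Restricted sums  Σ_{x ∈ xs, p x} f x.  The out- and in-sums of Defs are
-- the instances p e = (s e = v) and p e = (t e = v) over all edges.

restrict : Bool → ℤ → ℤ
restrict b z = if b then z else 0ℤ

sumWhere : {A : Set} → (A → Bool) → (A → ℤ) → List A → ℤ
sumWhere p f xs = sumℤ (map (λ x → restrict (p x) (f x)) xs)

restrict-0 : ∀ b → restrict b 0ℤ ≡ 0ℤ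
restrict-0 true  = refl
restrict-0 false = refl

restrict-+ : ∀ b u v → restrict b (u + v) ≡ restrict b u + restrict b v
restrict-+ true  u v = refl
restrict-+ false u v = refl

restrict-* : ∀ b c u → restrict b (c * u) ≡ c * restrict b u
restrict-* true  c u = refl
restrict-* false c u = sym (ℤP.*-zeroʳ c)

restrict-neg : ∀ b u → restrict b (- u) ≡ - restrict b u
restrict-neg true  u = refl
restrict-neg false u = refl

restrict-nonneg : ∀ b {u} → 0ℤ ≤ u → 0ℤ ≤ restrict b u
restrict-nonneg true  u≥0 = u≥0
restrict-nonneg false _   = ℤP.≤-refl

module _ {A : Set} (p : A → Bool) where

  sumWhere-cong : ∀ {f g : A → ℤ} xs → (∀ x → f x ≡ g x) → sumWhere p f xs ≡ sumWhere p g xs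
  sumWhere-cong xs f≗g = cong sumℤ (LP.map-cong (λ x → cong (restrict (p x)) (f≗g x)) xs)

  sumWhere-zero : ∀ xs → sumWhere p (λ _ → 0ℤ) xs ≡ 0ℤ
  sumWhere-zero []       = refl
  sumWhere-zero (x ∷ xs) = cong₂ _+_ (restrict-0 (p x)) (sumWhere-zero xs)

  sumWhere-+ : ∀ (f g : A → ℤ) xs →
               sumWhere p (λ x → f x + g x) xs ≡ sumWhere p f xs + sumWhere p g xs
  sumWhere-+ f g []       = refl
  sumWhere-+ f g (x ∷ xs) =
    trans (cong₂ _+_ (restrict-+ (p x) (f x) (g x)) (sumWhere-+ f g xs))
          (interchange (restrict (p x) (f x)) (restrict (p x) (g x)) (sumWhere p f xs) (sumWhere p g xs))

  sumWhere-* : ∀ c (f : A → ℤ) xs → sumWhere p (λ x → c * f x) xs ≡ c * sumWhere p f xs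
  sumWhere-* c f []       = sym (ℤP.*-zeroʳ c)
  sumWhere-* c f (x ∷ xs) =
    trans (cong₂ _+_ (restrict-* (p x) c (f x)) (sumWhere-* c f xs))
          (sym (ℤP.*-distribˡ-+ c (restrict (p x) (f x)) (sumWhere p f xs)))

  sumWhere-neg : ∀ (f : A → ℤ) xs → sumWhere p (λ x → - f x) xs ≡ - sumWhere p f xs
  sumWhere-neg f []       = refl
  sumWhere-neg f (x ∷ xs) =
    trans (cong₂ _+_ (restrict-neg (p x) (f x)) (sumWhere-neg f xs))
          (sym (ℤP.neg-distrib-+ (restrict (p x) (f x)) (sumWhere p f xs)))

  sumWhere-nonneg : ∀ {f : A → ℤ} → NonNeg f → ∀ xs → 0ℤ ≤ sumWhere p f xs
  sumWhere-nonneg f≥0 []       = ℤP.≤-refl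
  sumWhere-nonneg f≥0 (x ∷ xs) = ℤP.+-mono-≤ (restrict-nonneg (p x) (f≥0 x)) (sumWhere-nonneg f≥0 xs)

  sumWhere-member : ∀ {f : A → ℤ} → NonNeg f → ∀ {x xs} → x ∈ xs → T (p x) → f x ≤ sumWhere p f xs
  sumWhere-member {f} f≥0 {x} {_ ∷ xs} (here refl) px with p x
  ... | true = ℤP.i≤i+j (f x) _ {{ℤ.nonNegative (sumWhere-nonneg f≥0 xs)}}
  sumWhere-member {f} f≥0 {x} {y ∷ xs} (there x∈xs) px =
    ℤP.≤-trans (sumWhere-member f≥0 x∈xs px)
               (ℤP.i≤j+i _ (restrict (p y) (f y)) {{ℤ.nonNegative (restrict-nonneg (p y) (f≥0 y))}})

  sumWhere-positive : ∀ (f : A → ℤ) xs → 0ℤ < sumWhere p f xs → ∃[ x ] T (p x) × 0ℤ < f x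
  sumWhere-positive f []       (ℤ.+<+ ())
  sumWhere-positive f (x ∷ xs) sum>0 with p x in px | 0ℤ ℤ.<? f x
  ... | true  | yes fx>0 = x , subst T (sym px) tt , fx>0
  ... | true  | no  fx≯0 = sumWhere-positive f xs (0<a+b⇒0<b (ℤP.≮⇒≥ fx≯0) sum>0)
  ... | false | _        = sumWhere-positive f xs (0<a+b⇒0<b ℤP.≤-refl sum>0)

sumWhere-allFin-suc : ∀ {n} (q : Fin (suc n) → Bool) (f : Fin (suc n) → ℤ) →
  sumWhere q f (allFin (suc n)) ≡
    restrict (q Fin.zero) (f Fin.zero) + sumWhere (λ i → q (Fin.suc i)) (λ i → f (Fin.suc i)) (allFin n)
sumWhere-allFin-suc {n} q f =
  cong (_+_ (restrict (q Fin.zero) (f Fin.zero)))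
       (cong sumℤ (trans (LP.map-tabulate Fin.suc summand)
                         (sym (LP.map-tabulate (λ i → i) (λ i → summand (Fin.suc i))))))
  where
  summand : Fin (suc n) → ℤ
  summand i = restrict (q i) (f i)

-- Edge multiplicities of lists.  A list of edges es is identified with the
-- vector e ↦ (number of occurrences of e in es); this is cycleSum for cycles.

mult : ∀ {n} → List (Fin n) → Fin n → ℤ
mult es e = + length (filter (e ≟_) es)

unitVec : ∀ {n} → Fin n → Fin n → ℤ
unitVec x e = restrict (does (e ≟ x)) 1ℤ

mult-∷ : ∀ {n} (x : Fin n) xs e → mult (x ∷ xs) e ≡ unitVec x e + mult xs e
mult-∷ x xs e with e ≟ x
... | yes _ = refl
... | no  _ = refl

countWhere : {A : Set} → (A → Bool) → List A → ℕ
countWhere p []       = 0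
countWhere p (x ∷ xs) = if p x then suc (countWhere p xs) else countWhere p xs

countWhere-rotate : ∀ {A : Set} (p : A → Bool) x xs → countWhere p (xs ++ x ∷ []) ≡ countWhere p (x ∷ xs)
countWhere-rotate p x []       = refl
countWhere-rotate p x (y ∷ xs) rewrite countWhere-rotate p x xs with p y | p x
... | true  | true  = refl
... | true  | false = refl
... | false | true  = refl
... | false | false = refl

countWhere-all : ∀ {A : Set} (xs : List A) → countWhere (λ _ → true) xs ≡ length xs
countWhere-all []       = refl
countWhere-all (x ∷ xs) = cong suc (countWhere-all xs)

sumWhere-unitVec : ∀ {n} (q : Fin n → Bool) x → sumWhere q (unitVec x) (allFin n) ≡ restrict (q x) 1ℤ
sumWhere-unitVec {suc n} q Fin.zero =
  trans (sumWhere-allFin-suc q (unitVec Fin.zero))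
        (trans (cong (_+_ (restrict (q Fin.zero) 1ℤ)) (sumWhere-zero (λ i → q (Fin.suc i)) (allFin n)))
               (ℤP.+-identityʳ _))
sumWhere-unitVec {suc n} q (Fin.suc y) =
  trans (sumWhere-allFin-suc q (unitVec (Fin.suc y)))
        (trans (cong₂ _+_ (restrict-0 (q Fin.zero)) (sumWhere-unitVec (λ i → q (Fin.suc i)) y))
               (ℤP.+-identityˡ _))

sumWhere-mult : ∀ {n} (q : Fin n → Bool) es → sumWhere q (mult es) (allFin n) ≡ + countWhere q es
sumWhere-mult {n} q []       = sumWhere-zero q (allFin n)
sumWhere-mult {n} q (x ∷ xs) =
  trans (sumWhere-cong q (allFin n) (mult-∷ x xs))
  (trans (sumWhere-+ q (unitVec x) (mult xs) (allFin n))
  (trans (cong₂ _+_ (sumWhere-unitVec q x) (sumWhere-mult q xs)) (add-selected (q x))))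
  where
  add-selected : ∀ b → restrict b 1ℤ + + countWhere q xs ≡ + (if b then suc (countWhere q xs) else countWhere q xs)
  add-selected true  = refl
  add-selected false = refl

-- In a duplicate-free list every entry occurs once, so its multiplicity
-- vector lies below any nonnegative f that is positive on the list.
mult-below : ∀ {n} (f : Fin n → ℤ) {es} → Unique es → All (λ x → 0ℤ < f x) es → NonNeg f →
             ∀ e → mult es e ≤ f e
mult-below f []           []           f≥0 e = f≥0 e
mult-below f {x ∷ xs} (x∉xs ∷ u) (fx>0 ∷ pos) f≥0 e with e ≟ x
... | yes refl rewrite LP.filter-none (x ≟_) x∉xs = ℤP.i<j⇒suc[i]≤j fx>0
... | no  _    = mult-below f u pos f≥0 e

-- Distinct positions of a duplicate-free list hold distinct entries, so by
-- pigeonhole a duplicate-free list over Fin n has at most n entries.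
unique-lookup-injective : ∀ {A : Set} {xs : List A} → Unique xs →
                          ∀ {i j} → i Fin.< j → lookup xs i ≢ lookup xs j
unique-lookup-injective {xs = _ ∷ _} (x∉xs ∷ _) {Fin.zero}  {Fin.suc j} _ = All.lookup x∉xs (∈-lookup j)
unique-lookup-injective {xs = _ ∷ _} (_ ∷ u) {Fin.suc i} {Fin.suc j} (ℕ.s≤s i<j) =
  unique-lookup-injective u i<j

unique-length : ∀ {n} {xs : List (Fin n)} → Unique xs → length xs ℕ.≤ n
unique-length {xs = xs} u = ℕP.≮⇒≥ λ n<len →
  let i , j , i<j , same = FP.pigeonhole n<len (lookup xs) in unique-lookup-injective u i<j same

unique-prefix : ∀ {A : Set} xs {ys : List A} → Unique (xs ++ ys) → Unique xs
unique-prefix []       _        = []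
unique-prefix (x ∷ xs) (x∉ ∷ u) = AllP.++⁻ˡ xs x∉ ∷ unique-prefix xs u

module Combinations (G : Digraph) where

  Edge : Set
  Edge = Fin (nE G)

  srcAt tgtAt : Fin (nV G) → Edge → Bool
  srcAt v e = does (s G e ≟ v)
  tgtAt v e = does (t G e ≟ v)

  combination : List (ℤ × SimpleCycle G) → ZE G
  combination L e = sumℤ (map (λ cC → proj₁ cC * cycleSum G (proj₂ cC) e) L)

  combination-++ : ∀ L L′ e → combination (L ++ L′) e ≡ combination L e + combination L′ e
  combination-++ []            L′ e = sym (ℤP.+-identityˡ _)
  combination-++ ((c , C) ∷ L) L′ e =
    trans (cong (_+_ (c * cycleSum G C e)) (combination-++ L L′ e))
          (sym (ℤP.+-assoc (c * cycleSum G C e) (combination L e) (combination L′ e)))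

  balanced-cong : ∀ {f g : ZE G} → (∀ e → f e ≡ g e) → Balanced G f → Balanced G g
  balanced-cong f≗g bal v =
    trans (sym (sumWhere-cong (srcAt v) (allFin _) f≗g))
          (trans (bal v) (sumWhere-cong (tgtAt v) (allFin _) f≗g))

  balanced-zero : Balanced G (λ _ → 0ℤ)
  balanced-zero v = trans (sumWhere-zero (srcAt v) (allFin _)) (sym (sumWhere-zero (tgtAt v) (allFin _)))

  balanced-+ : ∀ {f g : ZE G} → Balanced G f → Balanced G g → Balanced G (λ e → f e + g e)
  balanced-+ {f} {g} balf balg v =
    trans (sumWhere-+ (srcAt v) f g (allFin _))
          (trans (cong₂ _+_ (balf v) (balg v)) (sym (sumWhere-+ (tgtAt v) f g (allFin _))))

  balanced-* : ∀ c {f : ZE G} → Balanced G f → Balanced G (λ e → c * f e)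
  balanced-* c {f} bal v =
    trans (sumWhere-* (srcAt v) c f (allFin _))
          (trans (cong (c *_) (bal v)) (sym (sumWhere-* (tgtAt v) c f (allFin _))))

  balanced-neg : ∀ {f : ZE G} → Balanced G f → Balanced G (λ e → - f e)
  balanced-neg {f} bal v =
    trans (sumWhere-neg (srcAt v) f (allFin _))
          (trans (cong -_ (bal v)) (sym (sumWhere-neg (tgtAt v) f (allFin _))))

  chain-count : ∀ (p : Fin (nV G) → Bool) x ys z → Chain G (x ∷ ys ++ z ∷ []) →
                countWhere (λ e → p (t G e)) (x ∷ ys) ≡ countWhere (λ e → p (s G e)) (ys ++ z ∷ [])
  chain-count p x []       z (tx≡sz , _) = cong (λ w → if p w then 1 else 0) tx≡sz
  chain-count p x (y ∷ ys) z (tx≡sy , chain) =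
    cong₂ (λ w k → if p w then suc k else k) tx≡sy (chain-count p y ys z chain)

  cycle-balanced : ∀ (C : SimpleCycle G) → Balanced G (cycleSum G C)
  cycle-balanced (e₀ ∷ rest , closed , _) v = begin
    outSum G (mult (e₀ ∷ rest)) v                        ≡⟨ sumWhere-mult (srcAt v) (e₀ ∷ rest) ⟩
    + countWhere (srcAt v) (e₀ ∷ rest)                   ≡⟨ cong +_ (countWhere-rotate (srcAt v) e₀ rest) ⟨
    + countWhere (srcAt v) (rest ++ e₀ ∷ [])             ≡⟨ cong +_ (chain-count (λ w → does (w ≟ v)) e₀ rest e₀ closed) ⟨
    + countWhere (tgtAt v) (e₀ ∷ rest)                   ≡⟨ sumWhere-mult (tgtAt v) (e₀ ∷ rest) ⟨
    inSum G (mult (e₀ ∷ rest)) v                         ∎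
    where open ≡-Reasoning

  combination-balanced : ∀ L → Balanced G (combination L)
  combination-balanced []            = balanced-zero
  combination-balanced ((c , C) ∷ L) = balanced-+ (balanced-* c (cycle-balanced C)) (combination-balanced L)

  combination-support : ∀ L e → combination L e ≢ 0ℤ → ∃[ C ] supp G (cycleSum G C) e
  combination-support []            e ≢0 = ⊥-elim (≢0 refl)
  combination-support ((c , C) ∷ L) e ≢0 with cycleSum G C e ℤ.≟ 0ℤ
  ... | no  C∋e = C , C∋e
  ... | yes C∌e = combination-support L e λ rest≡0 → ≢0 (begin
    c * cycleSum G C e + combination L e  ≡⟨ cong₂ (λ u w → c * u + w) C∌e rest≡0 ⟩
    c * 0ℤ + 0ℤ                           ≡⟨ trans (ℤP.+-identityʳ _) (ℤP.*-zeroʳ c) ⟩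
    0ℤ                                    ∎)
    where open ≡-Reasoning

  inM-cong : ∀ {f g : ZE G} → (∀ e → f e ≡ g e) → InM G f → InM G g
  inM-cong f≗g (L , f≡L) = L , λ e → trans (sym (f≗g e)) (f≡L e)

  inM-cycle : ∀ C → InM G (cycleSum G C)
  inM-cycle C = (1ℤ , C) ∷ [] , λ e → sym (trans (ℤP.+-identityʳ _) (ℤP.*-identityˡ _))

  inM-+ : ∀ {f g : ZE G} → InM G f → InM G g → InM G (λ e → f e + g e)
  inM-+ (L , f≡L) (L′ , g≡L′) =
    L ++ L′ , λ e → trans (cong₂ _+_ (f≡L e) (g≡L′ e)) (sym (combination-++ L L′ e))

  inM-neg : ∀ {f : ZE G} → InM G f → InM G (λ e → - f e)
  inM-neg (L , f≡L) = negateCoeffs L , λ e → trans (cong -_ (f≡L e)) (negate L e)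
    where
    negateCoeffs : List (ℤ × SimpleCycle G) → List (ℤ × SimpleCycle G)
    negateCoeffs = map (λ cC → - proj₁ cC , proj₂ cC)

    negate : ∀ L e → - combination L e ≡ combination (negateCoeffs L) e
    negate []            e = refl
    negate ((c , C) ∷ L) e =
      trans (ℤP.neg-distrib-+ (c * cycleSum G C e) (combination L e))
            (cong₂ _+_ (ℤP.neg-distribˡ-* c (cycleSum G C e)) (negate L e))

  NonNegCoeffs : List (ℤ × SimpleCycle G) → Set
  NonNegCoeffs = All (λ cC → 0ℤ ≤ proj₁ cC)

  combination-nonneg : ∀ {L} → NonNegCoeffs L → NonNeg (combination L)
  combination-nonneg []                                   e = ℤP.≤-refl
  combination-nonneg {(_ , C) ∷ _} (ℤ.+≤+ {n = m} _ ∷ cs) e =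
    ℤP.+-mono-≤ (subst (0ℤ ≤_) (ℤP.pos-* m _) (ℤ.+≤+ ℕ.z≤n)) (combination-nonneg cs e)

  combination-block : ∀ {A : Set} (g : A → List (ℤ × SimpleCycle G)) → (∀ x → NonNegCoeffs (g x)) →
                      ∀ {x xs} → x ∈ xs → ∀ e → combination (g x) e ≤ combination (concatMap g xs) e
  combination-block g g≥0 {x} {_ ∷ xs} (here refl) e rewrite combination-++ (g x) (concatMap g xs) e =
    ℤP.i≤i+j _ _ {{ℤ.nonNegative (combination-nonneg (concatMap-nonneg xs) e)}}
    where
    concatMap-nonneg : ∀ ys → NonNegCoeffs (concatMap g ys)
    concatMap-nonneg []       = []
    concatMap-nonneg (y ∷ ys) = AllP.++⁺ (g≥0 y) (concatMap-nonneg ys)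
  combination-block g g≥0 {x} {y ∷ xs} (there x∈xs) e rewrite combination-++ (g y) (concatMap g xs) e =
    ℤP.≤-trans (combination-block g g≥0 x∈xs e)
               (ℤP.i≤j+i _ _ {{ℤ.nonNegative (combination-nonneg (g≥0 y) e)}})

module Forward (G : Digraph) where
  open Combinations G

  inM⇒balanced×covered : ∀ S → InM G S → Balanced G S × SuppInCycles G S
  inM⇒balanced×covered S (L , S≡L) =
    balanced-cong (λ e → sym (S≡L e)) (combination-balanced L) ,
    λ e S∋e → combination-support L e (λ L≡0 → S∋e (trans (S≡L e) L≡0))

module CycleSearch (G : Digraph) (f : ZE G) (f≥0 : NonNeg f) (bal : Balanced G f) where
  open Combinations G

  Positive : Edge → Set
  Positive e = 0ℤ < f e

  PositiveCycle : Set
  PositiveCycle = Σ[ es ∈ List Edge ] IsSimpleCycle G es × All Positive es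

  -- The flow out of s(e) is at least f e > 0, so by balance some positive
  -- edge enters s(e).
  incoming : ∀ e → Positive e → Σ[ e′ ∈ Edge ] t G e′ ≡ s G e × Positive e′
  incoming e e>0 with sumWhere-positive (tgtAt (s G e)) f (allFin _) inflow>0
    where
    inflow>0 : 0ℤ < inSum G f (s G e)
    inflow>0 = subst (0ℤ <_) (bal (s G e))
      (ℤP.<-≤-trans e>0 (sumWhere-member (srcAt (s G e)) f≥0 (∈-allFin e) (does-refl (s G e))))
  ... | e′ , e′→e , e′>0 = e′ , does-sound e′→e , e′>0

  cut-chain : ∀ x pre b post z → Chain G (x ∷ pre ++ b ∷ post) → s G b ≡ s G z →
              Chain G (x ∷ pre ++ z ∷ [])
  cut-chain x []        b post z (tx≡sb , _)     sb≡sz = trans tx≡sb sb≡sz , tt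
  cut-chain x (y ∷ pre) b post z (tx≡sy , chain) sb≡sz = tx≡sy , cut-chain y pre b post z chain sb≡sz

  -- Here FirstView splits path as pre ++ b ∷ post, with b the first edge whose
  -- source is s(e′); the cycle is e′ ∷ pre.
  close : ∀ {e′ path} → Positive e′ → Chain G (e′ ∷ path) → Unique (map (s G) path) → All Positive path →
          First.FirstView (λ y → s G e′ ≢ s G y) (λ y → s G y ≡ s G e′) path → PositiveCycle
  close {e′} e′>0 chain u pos (First._++_∷_ {pre} fresh sb≡se′ post) =
    e′ ∷ pre ,
    (cut-chain e′ pre _ post e′ chain sb≡se′ ,
     AllP.map⁺ fresh ∷ unique-prefix (map (s G) pre) (subst Unique (LP.map-++ (s G) pre _) u)) ,
    e′>0 ∷ AllP.++⁻ˡ pre pos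

  same-source? : ∀ e′ y → (s G e′ ≢ s G y) ⊎ (s G y ≡ s G e′)
  same-source? e′ y with s G y ≟ s G e′
  ... | yes same = inj₂ same
  ... | no  new  = inj₁ (λ eq → new (sym eq))

  -- Extend a backward walk of positive edges with distinct sources until it
  -- closes up.  The walk never exceeds ∣V∣ edges, so ∣V∣ steps of fuel suffice.
  walk : (fuel : ℕ) (a : Edge) (path : List Edge) → nV G ℕ.< fuel ℕ.+ length (a ∷ path) →
         Chain G (a ∷ path) → Unique (map (s G) (a ∷ path)) → All Positive (a ∷ path) → PositiveCycle
  walk zero a path long _ u _ =
    ⊥-elim (ℕP.<⇒≱ long (subst (ℕ._≤ nV G) (LP.length-map (s G) (a ∷ path)) (unique-length u)))
  walk (suc fuel) a path long chain u pos@(a>0 ∷ _) with incoming a a>0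
  ... | e′ , e′→a , e′>0 with first (same-source? e′) (a ∷ path)
  ...   | inj₂ fresh =
    walk fuel e′ (a ∷ path) (subst (nV G ℕ.<_) (sym (ℕP.+-suc fuel (length (a ∷ path)))) long)
         (e′→a , chain) (AllP.map⁺ fresh ∷ u) (e′>0 ∷ pos)
  ...   | inj₁ repeat = close e′>0 (e′→a , chain) u pos (toView repeat)

  positive-cycle : ∀ e → Positive e → PositiveCycle
  positive-cycle e e>0 = walk (nV G) e [] (ℕP.m<m+n (nV G) (ℕ.s≤s ℕ.z≤n)) tt ([] ∷ []) (e>0 ∷ [])

module Decomposition (G : Digraph) where
  open Combinations G

  mass : ZE G → ℤ
  mass f = sumWhere (λ _ → true) f (allFin (nE G))

  mass-cycle : ∀ (C : SimpleCycle G) → mass (cycleSum G C) ≡ + length (proj₁ C)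
  mass-cycle (es , _) = trans (sumWhere-mult (λ _ → true) es) (cong +_ (countWhere-all es))

  cycle-nonempty : ∀ es → IsSimpleCycle G es → 1ℤ ≤ + length es
  cycle-nonempty (_ ∷ _) _ = ℤ.+≤+ (ℕ.s≤s ℕ.z≤n)

  cycle-edges-unique : ∀ es → IsSimpleCycle G es → Unique es
  cycle-edges-unique (_ ∷ _) (_ , sources-unique) = UniqueP.map⁻ sources-unique

  decompose : ∀ N (f : ZE G) → NonNeg f → Balanced G f → mass f ≤ + N → InM G f
  decompose N f f≥0 bal small with FP.any? (λ e → 0ℤ ℤ.<? f e)
  ... | no nowhere-positive =
    [] , λ e → ℤP.≤-antisym (ℤP.≮⇒≥ (λ e>0 → nowhere-positive (e , e>0))) (f≥0 e)
  decompose zero f f≥0 bal small | yes (e , e>0) =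
    ⊥-elim (ℤP.<-irrefl refl (ℤP.<-≤-trans e>0 (ℤP.≤-trans (sumWhere-member _ f≥0 (∈-allFin e) tt) small)))
  decompose (suc N) f f≥0 bal small | yes (e , e>0) with CycleSearch.positive-cycle G f f≥0 bal e e>0
  ... | es , isCycle , es>0 =
    inM-cong (λ x → plus-minus (cycleSum G C x) (f x))
             (inM-+ (inM-cycle C) (decompose N rest rest≥0 rest-balanced rest-small))
    where
    C : SimpleCycle G
    C = es , isCycle

    rest : ZE G
    rest x = f x - cycleSum G C x

    rest≥0 : NonNeg rest
    rest≥0 x = ℤP.i≤j⇒0≤j-i (mult-below f (cycle-edges-unique es isCycle) es>0 f≥0 x)

    rest-balanced : Balanced G rest
    rest-balanced = balanced-+ bal (balanced-neg (cycle-balanced C))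

    rest-small : mass rest ≤ + N
    rest-small = begin
      mass rest                        ≡⟨ sumWhere-+ _ f (λ x → - cycleSum G C x) (allFin _) ⟩
      mass f + mass (λ x → - cycleSum G C x)
                                       ≡⟨ cong (_+_ (mass f)) (trans (sumWhere-neg _ (cycleSum G C) (allFin _))
                                                                     (cong -_ (mass-cycle C))) ⟩
      mass f - + length es             ≤⟨ ℤP.+-mono-≤ small (ℤP.neg-mono-≤ (cycle-nonempty es isCycle)) ⟩
      + N                              ∎
      where open ℤP.≤-Reasoning

  decompose-nonneg : ∀ (f : ZE G) → NonNeg f → Balanced G f → InM G f
  decompose-nonneg f f≥0 bal =
    decompose ∣ mass f ∣ f f≥0 bal (ℤP.≤-reflexive (sym (ℤP.0≤i⇒+∣i∣≡i (sumWhere-nonneg _ f≥0 (allFin _)))))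

module Backward (G : Digraph) (S : ZE G) (bal : Balanced G S) (covered : SuppInCycles G S) where
  open Combinations G
  open Decomposition G

  correction : Edge → List (ℤ × SimpleCycle G)
  correction e with S e ℤ.≟ 0ℤ
  ... | yes _   = []
  ... | no  S∋e = (+ ∣ S e ∣ , proj₁ (covered e S∋e)) ∷ []

  correction-nonneg : ∀ e → NonNegCoeffs (correction e)
  correction-nonneg e with S e ℤ.≟ 0ℤ
  ... | yes _ = []
  ... | no  _ = ℤ.+≤+ ℕ.z≤n ∷ []

  correction-covers : ∀ e → - S e ≤ combination (correction e) e
  correction-covers e with S e ℤ.≟ 0ℤ
  ... | yes S≡0 rewrite S≡0 = ℤP.≤-refl
  ... | no  S∋e with covered e S∋e
  ...   | (_ , _) , C∋e = subst (- S e ≤_) (sym (ℤP.+-identityʳ _)) (neg≤∣∣* (S e) _ C∋e)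

  corrections : List (ℤ × SimpleCycle G)
  corrections = concatMap correction (allFin (nE G))

  compensation : ZE G
  compensation = combination corrections

  S+compensation≥0 : NonNeg (λ e → S e + compensation e)
  S+compensation≥0 e = subst (_≤ S e + compensation e) (ℤP.+-inverseʳ (S e))
    (ℤP.+-monoʳ-≤ (S e) (ℤP.≤-trans (correction-covers e)
                                      (combination-block correction correction-nonneg (∈-allFin e) e)))

  backward : InM G S
  backward =
    inM-cong (λ e → plus-minus-cancel (S e) (compensation e))
      (inM-+ (decompose-nonneg (λ e → S e + compensation e) S+compensation≥0
                               (balanced-+ bal (combination-balanced corrections)))
             (inM-neg (corrections , λ e → refl)))

lemma4p4 : (G : Digraph) → (S : ZE G) →
    InM G S ⇔ (Balanced G S × SuppInCycles G S)
lemma4p4 G S = mk⇔ (Forward.inM⇒balanced×covered G S)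
                   (λ (bal , covered) → Backward.backward G S bal covered)
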